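{- Let $n\ge 2$, let $A=[a_{ij}]$ be a real $n\times n$ matrix with zero diagonal, and let $f(\sigma)=\sum_{k=1}^{n-1}\sum_{l=k+1}^{n} a_{\sigma(k)\sigma(l)}$ be its LOP objective function on $\Sigma_n$. If $\hat f_{(n-1,1)}=0$, then for every permutation $[i_1\ i_2\ \cdots\ i_n]\in\Sigma_n$, $$f([i_1\ i_2\ i_3\ \cdots\ i_n])=f([i_n\ i_1\ i_2\ \cdots\ i_{n-1}]).$$
   Context: $\Sigma_n$ is the set of permutations of $\{1,\dots,n\}$, written $[\sigma(1)\ \cdots\ \sigma(n)]$ with $\sigma(k)$ the row/column index in position $k$. Fourier transform over the symmetric group: for a partition $\lambda$ of $n$, with $\rho_\lambda$ an irreducible matrix representation of $\Sigma_n$ indexed by $\lambda$, $\hat f_\lambda=\sum_{\sigma\in\Sigma_n} f(\sigma)\rho_\lambda(\sigma)$. -}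

module Defs where

open import Level using (Level)
open import Data.Nat using (ℕ; zero; suc; pred)
open import Data.Fin using (Fin; inject₁; fromℕ; _≟_)
open import Data.Fin.Properties using () renaming (_≟_ to _≟F_)
open import Data.List using (List; []; _∷_; map; concatMap; filter; foldr)
open import Data.List.Base using (allFin)
open import Data.Vec using (Vec; []; _∷_; lookup; toList; last; init)
open import Data.List.Relation.Unary.Unique.Propositional using (Unique)
import Data.List.Relation.Unary.Unique.DecPropositional as UDec
open import Relation.Nullary.Decidable using (does)
open import Data.Bool using (if_then_else_)
open import Algebra.Bundles using (CommutativeRing)

-- A permutation σ ∈ Σ_n is represented in one-line notation
-- [σ(1) ⋯ σ(n)] as a vector of length n over Fin n with pairwise distinct entries.
IsPerm : ∀ {n} → Vec (Fin n) n → Set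
IsPerm v = Unique (toList v)

allVecs : (n m : ℕ) → List (Vec (Fin n) m)
allVecs n zero    = [] ∷ []
allVecs n (suc m) = concatMap (λ i → map (i ∷_) (allVecs n m)) (allFin n)

allPerms : (n : ℕ) → List (Vec (Fin n) n)
allPerms n = filter (λ v → UDec.unique? {A = Fin n} _≟F_ (toList v)) (allVecs n n)

rotate : ∀ {a} {A : Set a} {n} → Vec A n → Vec A n
rotate {n = zero}  []  = []
rotate {n = suc k} v   = last v ∷ init v

module _ {c ℓ} (R : CommutativeRing c ℓ) where
  open CommutativeRing R

  sumL : ∀ {a} {A : Set a} → (A → Carrier) → List A → Carrier
  sumL g = foldr (λ x s → g x + s) 0#

  lop : ∀ {n} → (Fin n → Fin n → Carrier) → ∀ {m} → Vec (Fin n) m → Carrier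
  lop a []       = 0#
  lop a (x ∷ xs) = sumL (λ y → a x y) (toList xs) + lop a xs

  δ : ∀ {n} → Fin n → Fin n → Carrier
  δ x y = if does (x ≟ y) then 1# else 0#

  -- Irreducible representation of Σ_n indexed by (n-1,1) (standard representation):
  -- action σ(e_i) = e_{σ(i)} on the sum-zero subspace of R^n, written in the basis
  -- e_1 - e_n, …, e_{n-1} - e_n.
  ρStd : ∀ {n} → Vec (Fin n) n → Fin (pred n) → Fin (pred n) → Carrier
  ρStd {zero}  v () i
  ρStd {suc k} v p i = δ (lookup v (inject₁ i)) (inject₁ p) - δ (lookup v (fromℕ k)) (inject₁ p)

  fourierStd : ∀ {n} → (Vec (Fin n) n → Carrier) → Fin (pred n) → Fin (pred n) → Carrier
  fourierStd {n} f p i = sumL (λ σ → f σ * ρStd σ p i) (allPerms n)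

  natMul : ℕ → Carrier → Carrier
  natMul zero    x = 0#
  natMul (suc m) x = x + natMul m x

  -- no additive torsion (true for ℝ, any field of characteristic 0)
  TorsionFree : Set _
  TorsionFree = ∀ m x → natMul (suc m) x ≈ 0# → x ≈ 0#

-- Let netFlow x = Σ_y (a x y − a y x). Moving the first entry x of a permutation to the
-- end changes f by exactly netFlow x. Column 1 of f̂_(n−1,1) compares the sum of f over the
-- permutations with σ(1) = p against the sum over those with σ(n) = p; reindexing the latter
-- by the left rotation turns the difference into #{σ : σ(1) = p} · netFlow p, so netFlow p = 0
-- for p < n by torsion-freeness, and also netFlow n = 0 since netFlow sums to zero.
module Submission where

open import Defs
open import Data.Nat using (ℕ; zero; suc; _≤_; s≤s; z≤n)
open import Data.Nat.Properties using (n<1+n)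
open import Data.Fin using (Fin; zero; suc; fromℕ; inject₁; punchOut)
open import Data.Fin.Properties using (_≟_; punchOut-injective; pigeonhole; <⇒≢; fromℕ≢inject₁)
open import Data.Fin.Permutation.Components using (transpose; transpose-inverse)
open import Data.List as List using (List; []; _∷_; _++_; map; concatMap; filter; allFin; length)
open import Data.List.Membership.Propositional using (_∈_)
open import Data.List.Membership.Propositional.Properties
  using (∈-allFin; ∈-map⁺; ∈-concat⁺′; ∈-filter⁺; ∈-filter⁻)
import Data.List.Membership.DecPropositional as DecMembership
open import Data.List.Membership.Propositional.Properties.WithK using (unique∧set⇒bag)
open import Data.List.Relation.Binary.BagAndSetEquality using (∼bag⇒↭)
open import Data.List.Relation.Binary.Permutation.Propositional as ↭ using (_↭_; prep; swap; ↭⇒↭ₛ; ↭-sym)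
open import Data.List.Relation.Binary.Permutation.Propositional.Properties using (∷↭∷ʳ)
open import Data.List.Relation.Binary.Permutation.Setoid.Properties using (Unique-resp-↭)
open import Data.List.Relation.Unary.All as All using ()
open import Data.List.Relation.Unary.AllPairs using (_∷_)
open import Data.List.Relation.Unary.Any using (here; there)
open import Data.List.Relation.Unary.Unique.Propositional using (Unique)
open import Data.List.Relation.Unary.Unique.Propositional.Properties using (allFin⁺; tabulate⁺)
import Data.List.Relation.Unary.Unique.DecPropositional as UniqueDec
open import Data.Vec as Vec using (Vec; []; _∷_; _∷ʳ_; toList; lookup; tabulate)
open import Data.Vec.Properties using (toList-∷ʳ)
open import Data.Vec.Membership.Propositional.Properties using (∈-lookup; ∈-toList⁺)
open import Data.Bool using (true; false; if_then_else_)
open import Data.Empty using (⊥-elim)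
open import Data.Product using (∃; _×_; _,_; proj₂)
open import Data.Sum using (_⊎_; inj₁; inj₂)
open import Function using (_∘_)
open import Function.Bundles using (_⇔_; mk⇔; Equivalence)
open import Relation.Nullary using (Dec; yes; no)
open import Relation.Nullary.Decidable using (does; does-⇔)
open import Relation.Unary using (Pred; Decidable)
open import Relation.Binary.PropositionalEquality as ≡ using (_≡_; _≢_; cong; subst)
open import Algebra.Bundles using (CommutativeRing)

module Permutations where

  private variable
    A : Set
    n : ℕ

  rotateˡ : Vec A (suc n) → Vec A (suc n)
  rotateˡ (x ∷ xs) = xs ∷ʳ x

  rotateˡ-rotate : (xs : Vec A (suc n)) → rotateˡ (rotate xs) ≡ xs
  rotateˡ-rotate xs = ≡.sym (proj₂ (proj₂ (Vec.initLast xs)))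

  lookup-fromℕ-∷ʳ : (xs : Vec A n) (x : A) → lookup (xs ∷ʳ x) (fromℕ n) ≡ x
  lookup-fromℕ-∷ʳ []       x = ≡.refl
  lookup-fromℕ-∷ʳ (y ∷ xs) x = lookup-fromℕ-∷ʳ xs x

  fromℕ-or-inject₁ : (z : Fin (suc n)) → z ≡ fromℕ n ⊎ ∃ λ p → z ≡ inject₁ p
  fromℕ-or-inject₁ {zero}  zero    = inj₁ ≡.refl
  fromℕ-or-inject₁ {suc n} zero    = inj₂ (zero , ≡.refl)
  fromℕ-or-inject₁ {suc n} (suc z) with fromℕ-or-inject₁ z
  ... | inj₁ z≡fromℕ     = inj₁ (cong suc z≡fromℕ)
  ... | inj₂ (p , z≡inj) = inj₂ (suc p , cong suc z≡inj)

  lookup-injective : (xs : Vec A n) → Unique (toList xs) →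
                     ∀ {i j} → lookup xs i ≡ lookup xs j → i ≡ j
  lookup-injective (x ∷ xs) _          {zero}  {zero}  _  = ≡.refl
  lookup-injective (x ∷ xs) (x∉xs ∷ _) {zero}  {suc j} eq =
    ⊥-elim (All.lookup x∉xs (∈-toList⁺ (∈-lookup j xs)) eq)
  lookup-injective (x ∷ xs) (x∉xs ∷ _) {suc i} {zero}  eq =
    ⊥-elim (All.lookup x∉xs (∈-toList⁺ (∈-lookup i xs)) (≡.sym eq))
  lookup-injective (x ∷ xs) (_ ∷ uniq) {suc i} {suc j} eq = cong suc (lookup-injective xs uniq eq)

  -- A permutation missing z would be an injection Fin (suc n) → Fin n after punching z out.
  isPerm⇒∈ : (σ : Vec (Fin n) n) → IsPerm σ → ∀ z → z ∈ toList σ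
  isPerm⇒∈ {suc n} σ σ-perm z with DecMembership._∈?_ _≟_ z (toList σ)
  ... | yes z∈σ = z∈σ
  ... | no  z∉σ =
    let i , j , i<j , same = pigeonhole (n<1+n n) punched
    in ⊥-elim (<⇒≢ i<j (lookup-injective σ σ-perm (punchOut-injective {i = z} _ _ same)))
    where
    punched : Fin (suc n) → Fin n
    punched i = punchOut {i = z} {j = lookup σ i}
                  (λ z≡σi → z∉σ (subst (_∈ toList σ) (≡.sym z≡σi) (∈-toList⁺ (∈-lookup i σ))))

  isPerm⇒↭allFin : (σ : Vec (Fin n) n) → IsPerm σ → toList σ ↭ allFin n
  isPerm⇒↭allFin {n} σ σ-perm =
    ∼bag⇒↭ (unique∧set⇒bag σ-perm (allFin⁺ n)
      (mk⇔ (λ _ → ∈-allFin _) (λ _ → isPerm⇒∈ σ σ-perm _)))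

  unique-rotateˡ : (xs : Vec A (suc n)) → Unique (toList xs) ⇔ Unique (toList (rotateˡ xs))
  unique-rotateˡ (x ∷ xs) = mk⇔
    (λ uniq → subst Unique (≡.sym (toList-∷ʳ x xs))
                (Unique-resp-↭ (≡.setoid _) (↭⇒↭ₛ x∷xs↭xs∷ʳx) uniq))
    (λ uniq → Unique-resp-↭ (≡.setoid _) (↭⇒↭ₛ (↭-sym x∷xs↭xs∷ʳx))
                (subst Unique (toList-∷ʳ x xs) uniq))
    where
    x∷xs↭xs∷ʳx : x ∷ toList xs ↭ toList xs List.∷ʳ x
    x∷xs↭xs∷ʳx = ∷↭∷ʳ x (toList xs)

  isPerm? : (σ : Vec (Fin n) n) → Dec (IsPerm σ)
  isPerm? {n} σ = UniqueDec.unique? {A = Fin n} _≟_ (toList σ)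

  ∈-allVecs : ∀ m (v : Vec (Fin n) m) → v ∈ allVecs n m
  ∈-allVecs zero    []      = here ≡.refl
  ∈-allVecs (suc m) (x ∷ v) = ∈-concat⁺′ (∈-map⁺ (x ∷_) (∈-allVecs m v)) (∈-map⁺ _ (∈-allFin x))

  ∈-allPerms : (σ : Vec (Fin n) n) → IsPerm σ → σ ∈ allPerms n
  ∈-allPerms {n} σ = ∈-filter⁺ isPerm? (∈-allVecs n σ)

  ∈-allPerms⇒isPerm : {σ : Vec (Fin n) n} → σ ∈ allPerms n → IsPerm σ
  ∈-allPerms⇒isPerm {n} = proj₂ ∘ ∈-filter⁻ isPerm? {xs = allVecs n n}

  toList-tabulate : (f : Fin n → A) → toList (tabulate f) ≡ List.tabulate f
  toList-tabulate {zero}  f = ≡.refl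
  toList-tabulate {suc n} f = cong (f zero ∷_) (toList-tabulate (f ∘ suc))

  ∃-perm-starting-with : (p : Fin (suc n)) → ∃ λ σ → σ ∈ allPerms (suc n) × lookup σ zero ≡ p
  ∃-perm-starting-with {n} p = σ , ∈-allPerms σ σ-perm , ≡.refl
    where
    σ : Vec (Fin (suc n)) (suc n)
    σ = tabulate (transpose zero p)
    transpose-injective : ∀ {i j} → transpose zero p i ≡ transpose zero p j → i ≡ j
    transpose-injective {i} {j} eq = ≡.trans (≡.sym (transpose-inverse p zero))
      (≡.trans (cong (transpose p zero) eq) (transpose-inverse p zero))
    σ-perm : IsPerm σ
    σ-perm = subst Unique (≡.sym (toList-tabulate (transpose zero p))) (tabulate⁺ transpose-injective)

module ListSums {c ℓ} (R : CommutativeRing c ℓ) where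

  open CommutativeRing R
  open import Relation.Binary.Reasoning.Setoid setoid
  open import Algebra.Properties.CommutativeSemigroup +-commutativeSemigroup using (interchange)
  open import Algebra.Properties.AbelianGroup +-abelianGroup using (⁻¹-∙-comm)
  open import Algebra.Properties.Group +-group using (ε⁻¹≈ε)

  private variable
    A B : Set

  ∑ : (A → Carrier) → List A → Carrier
  ∑ = sumL R

  ∑-cong∈ : {F G : A → Carrier} (xs : List A) → (∀ {x} → x ∈ xs → F x ≈ G x) → ∑ F xs ≈ ∑ G xs
  ∑-cong∈ []       F≈G = refl
  ∑-cong∈ (x ∷ xs) F≈G = +-cong (F≈G (here ≡.refl)) (∑-cong∈ xs (F≈G ∘ there))

  ∑-cong : {F G : A → Carrier} (xs : List A) → (∀ x → F x ≈ G x) → ∑ F xs ≈ ∑ G xs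
  ∑-cong xs F≈G = ∑-cong∈ xs (λ {x} _ → F≈G x)

  ∑-++ : (F : A → Carrier) (xs ys : List A) → ∑ F (xs ++ ys) ≈ ∑ F xs + ∑ F ys
  ∑-++ F []       ys = sym (+-identityˡ _)
  ∑-++ F (x ∷ xs) ys = trans (+-congˡ (∑-++ F xs ys)) (sym (+-assoc _ _ _))

  ∑-∷ʳ : (F : A → Carrier) (xs : List A) (x : A) → ∑ F (xs List.∷ʳ x) ≈ ∑ F xs + F x
  ∑-∷ʳ F xs x = trans (∑-++ F xs (x ∷ [])) (+-congˡ (+-identityʳ _))

  ∑-map : (F : B → Carrier) (g : A → B) (xs : List A) → ∑ F (map g xs) ≡ ∑ (F ∘ g) xs
  ∑-map F g []       = ≡.refl
  ∑-map F g (x ∷ xs) = cong (F (g x) +_) (∑-map F g xs)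

  ∑-concatMap : (F : B → Carrier) (h : A → List B) (xs : List A) →
                ∑ F (concatMap h xs) ≈ ∑ (λ x → ∑ F (h x)) xs
  ∑-concatMap F h []       = refl
  ∑-concatMap F h (x ∷ xs) = trans (∑-++ F (h x) (concatMap h xs)) (+-congˡ (∑-concatMap F h xs))

  ∑-0 : (xs : List A) → ∑ (λ _ → 0#) xs ≈ 0#
  ∑-0 []       = refl
  ∑-0 (x ∷ xs) = trans (+-congˡ (∑-0 xs)) (+-identityˡ _)

  ∑-+ : (F G : A → Carrier) (xs : List A) → ∑ (λ x → F x + G x) xs ≈ ∑ F xs + ∑ G xs
  ∑-+ F G []       = sym (+-identityˡ _)
  ∑-+ F G (x ∷ xs) = trans (+-congˡ (∑-+ F G xs)) (interchange _ _ _ _)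

  ∑-neg : (F : A → Carrier) (xs : List A) → ∑ (λ x → - F x) xs ≈ - ∑ F xs
  ∑-neg F []       = sym ε⁻¹≈ε
  ∑-neg F (x ∷ xs) = trans (+-congˡ (∑-neg F xs)) (⁻¹-∙-comm _ _)

  ∑-− : (F G : A → Carrier) (xs : List A) → ∑ (λ x → F x - G x) xs ≈ ∑ F xs - ∑ G xs
  ∑-− F G xs = trans (∑-+ F (λ x → - G x) xs) (+-congˡ (∑-neg G xs))

  ∑-comm : (F : A → B → Carrier) (xs : List A) (ys : List B) →
           ∑ (λ x → ∑ (F x) ys) xs ≈ ∑ (λ y → ∑ (λ x → F x y) xs) ys
  ∑-comm F []       ys = sym (∑-0 ys)
  ∑-comm F (x ∷ xs) ys = trans (+-congˡ (∑-comm F xs ys)) (sym (∑-+ (F x) _ ys))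

  ∑-↭ : (F : A → Carrier) {xs ys : List A} → xs ↭ ys → ∑ F xs ≈ ∑ F ys
  ∑-↭ F ↭.refl         = refl
  ∑-↭ F (prep x p)     = +-congˡ (∑-↭ F p)
  ∑-↭ F (swap x y p)   = begin
    F x + (F y + _) ≈⟨ +-assoc _ _ _ ⟨
    (F x + F y) + _ ≈⟨ +-cong (+-comm _ _) (∑-↭ F p) ⟩
    (F y + F x) + _ ≈⟨ +-assoc _ _ _ ⟩
    F y + (F x + _) ∎
  ∑-↭ F (↭.trans p q) = trans (∑-↭ F p) (∑-↭ F q)

  ∑-filter : ∀ {p} {P : Pred A p} (P? : Decidable P) (F : A → Carrier) (xs : List A) →
             ∑ F (filter P? xs) ≈ ∑ (λ x → if does (P? x) then F x else 0#) xs
  ∑-filter P? F []       = refl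
  ∑-filter P? F (x ∷ xs) with does (P? x)
  ... | true  = +-congˡ (∑-filter P? F xs)
  ... | false = trans (∑-filter P? F xs) (sym (+-identityˡ _))

  ∑-antisymmetric : (g : A → A → Carrier) (xs : List A) →
                    ∑ (λ x → ∑ (λ y → g x y - g y x) xs) xs ≈ 0#
  ∑-antisymmetric g xs = begin
    ∑ (λ x → ∑ (λ y → g x y - g y x) xs) xs
      ≈⟨ ∑-cong xs (λ x → ∑-− (g x) (λ y → g y x) xs) ⟩
    ∑ (λ x → ∑ (g x) xs - ∑ (λ y → g y x) xs) xs
      ≈⟨ ∑-− _ _ xs ⟩
    total - ∑ (λ x → ∑ (λ y → g y x) xs) xs
      ≈⟨ +-congˡ (-‿cong (∑-comm (λ x y → g y x) xs xs)) ⟩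
    total - total
      ≈⟨ -‿inverseʳ total ⟩
    0#
      ∎
    where
    total : Carrier
    total = ∑ (λ x → ∑ (g x) xs) xs

  δ-substitute : ∀ {n} (g : Fin n → Carrier) (x p : Fin n) → g x * δ R x p ≈ δ R x p * g p
  δ-substitute g x p with x ≟ p
  ... | yes ≡.refl = *-comm _ _
  ... | no  _      = trans (zeroʳ _) (sym (zeroˡ _))

  δ-diag : ∀ {n} (x : Fin n) → δ R x x ≈ 1#
  δ-diag x with x ≟ x
  ... | yes _    = refl
  ... | no  x≢x = ⊥-elim (x≢x ≡.refl)

  δ-≢ : ∀ {n} {x y : Fin n} → x ≢ y → δ R x y ≈ 0#
  δ-≢ {x = x} {y} x≢y with x ≟ y
  ... | yes x≡y = ⊥-elim (x≢y x≡y)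
  ... | no  _   = refl

  ∑-δ : ∀ {n} (h : A → Fin n) (p : Fin n) (k : Carrier) (xs : List A) →
        ∑ (λ x → δ R (h x) p * k) xs ≈ natMul R (length (filter (λ x → h x ≟ p) xs)) k
  ∑-δ h p k []       = refl
  ∑-δ h p k (x ∷ xs) with h x ≟ p
  ... | yes _ = +-cong (*-identityˡ k) (∑-δ h p k xs)
  ... | no  _ = trans (+-cong (zeroˡ k) (∑-δ h p k xs)) (+-identityˡ _)

  -- By ∑-δ the sum is (#hits) · k, and x ∈ xs makes the number of hits positive.
  torsionFree-∑-δ : TorsionFree R → ∀ {n} {h : A → Fin n} {p : Fin n} {k : Carrier} {x : A}
                    (xs : List A) → x ∈ xs → h x ≡ p → ∑ (λ y → δ R (h y) p * k) xs ≈ 0# → k ≈ 0#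
  torsionFree-∑-δ tf {h = h} {p} {k} xs x∈xs hx≡p ∑≈0
    with filter (λ y → h y ≟ p) xs | ∈-filter⁺ (λ y → h y ≟ p) x∈xs hx≡p | ∑-δ h p k xs
  ... | _ ∷ hits | _ | ∑≈count = tf (length hits) k (trans (sym ∑≈count) ∑≈0)

module SymmetricGroupSums {c ℓ} (R : CommutativeRing c ℓ) where

  open CommutativeRing R
  open import Relation.Binary.Reasoning.Setoid setoid
  open ListSums R
  open Permutations

  ∑-allVecs-∷ : ∀ {n m} (F : Vec (Fin n) (suc m) → Carrier) →
                ∑ F (allVecs n (suc m)) ≈ ∑ (λ i → ∑ (λ v → F (i ∷ v)) (allVecs n m)) (allFin n)
  ∑-allVecs-∷ {n} {m} F = trans (∑-concatMap F _ (allFin n))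
    (∑-cong (allFin n) (λ i → reflexive (∑-map F (i ∷_) (allVecs n m))))

  ∑-allVecs-∷ʳ : ∀ {n} m (F : Vec (Fin n) (suc m) → Carrier) →
                 ∑ F (allVecs n (suc m)) ≈ ∑ (λ v → ∑ (λ i → F (v ∷ʳ i)) (allFin n)) (allVecs n m)
  ∑-allVecs-∷ʳ {n} zero F = begin
    ∑ F (allVecs n 1)                          ≈⟨ ∑-allVecs-∷ F ⟩
    ∑ (λ i → F (i ∷ []) + 0#) (allFin n)       ≈⟨ ∑-cong (allFin n) (λ i → +-identityʳ _) ⟩
    ∑ (λ i → F (i ∷ [])) (allFin n)            ≈⟨ +-identityʳ _ ⟨
    ∑ (λ i → F (i ∷ [])) (allFin n) + 0#       ∎
  ∑-allVecs-∷ʳ {n} (suc m) F = begin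
    ∑ F (allVecs n (suc (suc m)))
      ≈⟨ ∑-allVecs-∷ F ⟩
    ∑ (λ i → ∑ (λ v → F (i ∷ v)) (allVecs n (suc m))) (allFin n)
      ≈⟨ ∑-cong (allFin n) (λ i → ∑-allVecs-∷ʳ m (λ v → F (i ∷ v))) ⟩
    ∑ (λ i → ∑ (λ w → ∑ (λ j → F (i ∷ (w ∷ʳ j))) (allFin n)) (allVecs n m)) (allFin n)
      ≈⟨ ∑-allVecs-∷ (λ v → ∑ (λ j → F (v ∷ʳ j)) (allFin n)) ⟨
    ∑ (λ v → ∑ (λ j → F (v ∷ʳ j)) (allFin n)) (allVecs n (suc m))
      ∎

  ∑-allVecs-rotateˡ : ∀ {n m} (F : Vec (Fin n) (suc m) → Carrier) →
                      ∑ (F ∘ rotateˡ) (allVecs n (suc m)) ≈ ∑ F (allVecs n (suc m))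
  ∑-allVecs-rotateˡ {n} {m} F = begin
    ∑ (F ∘ rotateˡ) (allVecs n (suc m))                       ≈⟨ ∑-allVecs-∷ (F ∘ rotateˡ) ⟩
    ∑ (λ i → ∑ (λ v → F (v ∷ʳ i)) (allVecs n m)) (allFin n)   ≈⟨ ∑-comm _ (allFin n) (allVecs n m) ⟩
    ∑ (λ v → ∑ (λ i → F (v ∷ʳ i)) (allFin n)) (allVecs n m)   ≈⟨ ∑-allVecs-∷ʳ m F ⟨
    ∑ F (allVecs n (suc m))                                   ∎

  ∑-allPerms-rotateˡ : ∀ {n} (F : Vec (Fin (suc n)) (suc n) → Carrier) →
                       ∑ (F ∘ rotateˡ) (allPerms (suc n)) ≈ ∑ F (allPerms (suc n))
  ∑-allPerms-rotateˡ {n} F = begin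
    ∑ (F ∘ rotateˡ) (allPerms (suc n))         ≈⟨ ∑-filter isPerm? (F ∘ rotateˡ) vecs ⟩
    ∑ (λ v → if does (isPerm? v) then F (rotateˡ v) else 0#) vecs
      ≈⟨ ∑-cong vecs (reflexive ∘ onPerms-rotateˡ) ⟩
    ∑ (onPerms ∘ rotateˡ) vecs                  ≈⟨ ∑-allVecs-rotateˡ onPerms ⟩
    ∑ onPerms vecs                              ≈⟨ ∑-filter isPerm? F vecs ⟨
    ∑ F (allPerms (suc n))                      ∎
    where
    vecs : List (Vec (Fin (suc n)) (suc n))
    vecs = allVecs (suc n) (suc n)
    onPerms : Vec (Fin (suc n)) (suc n) → Carrier
    onPerms v = if does (isPerm? v) then F v else 0#
    onPerms-rotateˡ : ∀ v → (if does (isPerm? v) then F (rotateˡ v) else 0#) ≡ onPerms (rotateˡ v)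
    onPerms-rotateˡ v = cong (λ b → if b then F (rotateˡ v) else 0#)
                          (does-⇔ (unique-rotateˡ v) (isPerm? v) (isPerm? (rotateˡ v)))

module LinearOrdering {c ℓ} (R : CommutativeRing c ℓ) {n : ℕ}
                      (a : Fin n → Fin n → CommutativeRing.Carrier R) where

  open CommutativeRing R hiding (zero)
  open import Relation.Binary.Reasoning.Setoid setoid
  open import Algebra.Properties.CommutativeSemigroup +-commutativeSemigroup using (interchange)
  open import Algebra.Properties.AbelianGroup +-abelianGroup using (⁻¹-∙-comm)
  open ListSums R
  open Permutations

  netFlow : Fin n → Carrier
  netFlow x = ∑ (λ y → a x y - a y x) (allFin n)

  ∑-netFlow : ∑ netFlow (allFin n) ≈ 0#
  ∑-netFlow = ∑-antisymmetric a (allFin n)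

  lop-∷ʳ : ∀ {m} (w : Vec (Fin n) m) (x : Fin n) →
           lop R a (w ∷ʳ x) ≈ lop R a w + ∑ (λ y → a y x) (toList w)
  lop-∷ʳ []      x = refl
  lop-∷ʳ (y ∷ w) x = begin
    ∑ (a y) (toList (w ∷ʳ x)) + lop R a (w ∷ʳ x)
      ≈⟨ +-cong (trans (reflexive (cong (∑ (a y)) (toList-∷ʳ x w))) (∑-∷ʳ (a y) (toList w) x))
                (lop-∷ʳ w x) ⟩
    (∑ (a y) (toList w) + a y x) + (lop R a w + ∑ (λ z → a z x) (toList w))
      ≈⟨ interchange _ _ _ _ ⟩
    (∑ (a y) (toList w) + lop R a w) + (a y x + ∑ (λ z → a z x) (toList w))
      ∎

  [x+y]-[y+z]≈x-z : ∀ x y z → (x + y) - (y + z) ≈ x - z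
  [x+y]-[y+z]≈x-z x y z = begin
    (x + y) + - (y + z)    ≈⟨ +-congˡ (⁻¹-∙-comm y z) ⟨
    (x + y) + (- y + - z)  ≈⟨ +-congˡ (+-comm _ _) ⟩
    (x + y) + (- z + - y)  ≈⟨ interchange _ _ _ _ ⟩
    (x - z) + (y - y)      ≈⟨ +-congˡ (-‿inverseʳ y) ⟩
    (x - z) + 0#           ≈⟨ +-identityʳ _ ⟩
    x - z                  ∎

  -- Only the pairs involving x change order, and x itself contributes a x x − a x x = 0.
  lop-rotateˡ : ∀ {m} (σ : Vec (Fin n) (suc m)) → toList σ ↭ allFin n →
                lop R a σ - lop R a (rotateˡ σ) ≈ netFlow (lookup σ zero)
  lop-rotateˡ (x ∷ w) x∷w↭allFin = begin
    lop R a (x ∷ w) - lop R a (w ∷ʳ x)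
      ≈⟨ +-congˡ (-‿cong (lop-∷ʳ w x)) ⟩
    (∑ (a x) ws + lop R a w) - (lop R a w + ∑ (λ y → a y x) ws)
      ≈⟨ [x+y]-[y+z]≈x-z _ _ _ ⟩
    ∑ (a x) ws - ∑ (λ y → a y x) ws
      ≈⟨ ∑-− (a x) (λ y → a y x) ws ⟨
    ∑ flow ws
      ≈⟨ +-identityˡ _ ⟨
    0# + ∑ flow ws
      ≈⟨ +-congʳ (-‿inverseʳ (a x x)) ⟨
    ∑ flow (x ∷ ws)
      ≈⟨ ∑-↭ flow x∷w↭allFin ⟩
    netFlow x
      ∎
    where
    ws : List (Fin n)
    ws = toList w
    flow : Fin n → Carrier
    flow y = a x y - a y x

module VanishingFourierCoefficient {c ℓ} (R : CommutativeRing c ℓ) (torsionFree : TorsionFree R)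
  {k : ℕ} (a : Fin (suc (suc k)) → Fin (suc (suc k)) → CommutativeRing.Carrier R)
  (f̂≈0 : ∀ p q → CommutativeRing._≈_ R (fourierStd R (lop R a) p q) (CommutativeRing.0# R)) where

  open CommutativeRing R hiding (zero)
  open import Relation.Binary.Reasoning.Setoid setoid
  open import Algebra.Properties.Ring ring using (x[y-z]≈xy-xz; [y-z]x≈yx-zx)
  open import Algebra.Properties.Group +-group using (x∙y⁻¹≈ε⇒x≈y)
  open ListSums R
  open SymmetricGroupSums R
  open LinearOrdering R a
  open Permutations

  N : ℕ
  N = suc (suc k)

  f : Vec (Fin N) N → Carrier
  f = lop R a

  perms : List (Vec (Fin N) N)
  perms = allPerms N

  first : Vec (Fin N) N → Fin N
  first σ = lookup σ zero

  -- Entry (p, 1) of f̂, with its σ(n)-part reindexed by σ ↦ rotateˡ σ.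
  ∑-rotation-defect : ∀ p → ∑ (λ σ → (f σ - f (rotateˡ σ)) * δ R (first σ) (inject₁ p)) perms ≈ 0#
  ∑-rotation-defect p = begin
    ∑ (λ σ → (f σ - f (rotateˡ σ)) * δ₁ σ) perms
      ≈⟨ ∑-cong perms (λ σ → [y-z]x≈yx-zx _ _ _) ⟩
    ∑ (λ σ → f σ * δ₁ σ - f (rotateˡ σ) * δ₁ σ) perms
      ≈⟨ ∑-− _ _ perms ⟩
    ∑ (λ σ → f σ * δ₁ σ) perms - ∑ (λ σ → f (rotateˡ σ) * δ₁ σ) perms
      ≈⟨ +-congˡ (-‿cong (∑-cong perms (λ σ → *-congˡ (reflexive (δ₁≡δₙ∘rotateˡ σ))))) ⟩
    ∑ (λ σ → f σ * δ₁ σ) perms - ∑ (λ σ → f (rotateˡ σ) * δₙ (rotateˡ σ)) perms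
      ≈⟨ +-congˡ (-‿cong (∑-allPerms-rotateˡ (λ σ → f σ * δₙ σ))) ⟩
    ∑ (λ σ → f σ * δ₁ σ) perms - ∑ (λ σ → f σ * δₙ σ) perms
      ≈⟨ ∑-− _ _ perms ⟨
    ∑ (λ σ → f σ * δ₁ σ - f σ * δₙ σ) perms
      ≈⟨ ∑-cong perms (λ σ → x[y-z]≈xy-xz _ _ _) ⟨
    fourierStd R f p zero
      ≈⟨ f̂≈0 p zero ⟩
    0#  ∎
    where
    δ₁ δₙ : Vec (Fin N) N → Carrier
    δ₁ σ = δ R (first σ) (inject₁ p)
    δₙ σ = δ R (lookup σ (fromℕ (suc k))) (inject₁ p)
    δ₁≡δₙ∘rotateˡ : ∀ σ → δ₁ σ ≡ δₙ (rotateˡ σ)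
    δ₁≡δₙ∘rotateˡ (x ∷ w) = cong (λ z → δ R z (inject₁ p)) (≡.sym (lookup-fromℕ-∷ʳ w x))

  netFlow-inject₁ : ∀ p → netFlow (inject₁ p) ≈ 0#
  netFlow-inject₁ p =
    let σ , σ∈perms , σ₁≡p = ∃-perm-starting-with (inject₁ p)
    in torsionFree-∑-δ torsionFree {h = first} perms σ∈perms σ₁≡p (begin
      ∑ (λ σ → δ R (first σ) (inject₁ p) * netFlow (inject₁ p)) perms
        ≈⟨ ∑-cong∈ perms defect≈flow ⟨
      ∑ (λ σ → (f σ - f (rotateˡ σ)) * δ R (first σ) (inject₁ p)) perms
        ≈⟨ ∑-rotation-defect p ⟩
      0# ∎)
    where
    defect≈flow : ∀ {σ} → σ ∈ perms →
                  (f σ - f (rotateˡ σ)) * δ R (first σ) (inject₁ p)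
                    ≈ δ R (first σ) (inject₁ p) * netFlow (inject₁ p)
    defect≈flow {σ} σ∈perms = trans
      (*-congʳ (lop-rotateˡ σ (isPerm⇒↭allFin σ (∈-allPerms⇒isPerm σ∈perms))))
      (δ-substitute netFlow (first σ) (inject₁ p))

  last : Fin N
  last = fromℕ (suc k)

  netFlow-last : netFlow last ≈ 0#
  netFlow-last = torsionFree-∑-δ torsionFree {h = λ y → y} (allFin N) (∈-allFin last) ≡.refl (begin
    ∑ (λ y → δ R y last * netFlow last) (allFin N) ≈⟨ ∑-cong (allFin N) concentrated ⟨
    ∑ netFlow (allFin N)                           ≈⟨ ∑-netFlow ⟩
    0#                                             ∎)
    where
    concentrated : ∀ y → netFlow y ≈ δ R y last * netFlow last
    concentrated y with fromℕ-or-inject₁ y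
    ... | inj₁ ≡.refl       = trans (sym (*-identityˡ _)) (*-congʳ (sym (δ-diag last)))
    ... | inj₂ (p , ≡.refl) = trans (netFlow-inject₁ p)
      (sym (trans (*-congʳ (δ-≢ (fromℕ≢inject₁ {i = p} ∘ ≡.sym))) (zeroˡ _)))

  netFlow≈0 : ∀ z → netFlow z ≈ 0#
  netFlow≈0 z with fromℕ-or-inject₁ z
  ... | inj₁ ≡.refl       = netFlow-last
  ... | inj₂ (p , ≡.refl) = netFlow-inject₁ p

  lop-rotate : (σ : Vec (Fin N) N) → IsPerm σ → f σ ≈ f (rotate σ)
  lop-rotate σ σ-perm = begin
    f σ                     ≡⟨ cong f (rotateˡ-rotate σ) ⟨
    f (rotateˡ (rotate σ))  ≈⟨ x∙y⁻¹≈ε⇒x≈y _ _ defect≈0 ⟨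
    f (rotate σ)            ∎
    where
    τ-perm : IsPerm (rotate σ)
    τ-perm = Equivalence.from (unique-rotateˡ (rotate σ)) (subst IsPerm (≡.sym (rotateˡ-rotate σ)) σ-perm)
    defect≈0 : f (rotate σ) - f (rotateˡ (rotate σ)) ≈ 0#
    defect≈0 = trans (lop-rotateˡ (rotate σ) (isPerm⇒↭allFin (rotate σ) τ-perm)) (netFlow≈0 _)

lemma1 : ∀ {c ℓ} (R : CommutativeRing c ℓ) → TorsionFree R →
         (n : ℕ) → 2 ≤ n →
         (a : Fin n → Fin n → CommutativeRing.Carrier R) →
         (∀ i → CommutativeRing._≈_ R (a i i) (CommutativeRing.0# R)) →
         (∀ p q → CommutativeRing._≈_ R (fourierStd R (lop R a) p q) (CommutativeRing.0# R)) →
         (σ : Vec (Fin n) n) → IsPerm σ →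
         CommutativeRing._≈_ R (lop R a σ) (lop R a (rotate σ))
lemma1 R torsionFree (suc (suc k)) (s≤s (s≤s z≤n)) a _ f̂≈0 =
  VanishingFourierCoefficient.lop-rotate R torsionFree a f̂≈0
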